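{- A flat disunification problem $\Gamma$ has a local solution iff the propositional clause set $\mathsf{Cl}(\Gamma)$ is satisfiable.
   Context: $\mathcal{EL}$ concept terms are built from concept names and role names using $C\sqcap D$, $\exists r.C$ and $\top$; $C\sqsubseteq D$ means $C^{\mathcal I}\subseteq D^{\mathcal I}$ in every interpretation. Concept names are split into variables $N_v$ and constants $N_c$. $\Gamma$ is a flat disunification problem: subsumptions $C_1\sqcap\dots\sqcap C_n\sqsubseteq^? D$ of flat atoms (concept names or $\exists r.A$, $A$ a concept name) and dissubsumptions, all of the form $X\not\sqsubseteq^? Y$ with variables $X,Y$ (w.l.o.g.); $N_v,N_c,N_R$ are exactly the variables, constants and roles occurring in $\Gamma$. A solution is a substitution of ground terms for variables with $\sigma(C)\sqsubseteq\sigma(D)$ for each subsumption and $\sigma(X)\not\sqsubseteq\sigma(Y)$ for each dissubsumption. $\mathsf{At}$ = atoms occurring as subterms of $\Gamma$, $\mathsf{At_{nv}}=\mathsf{At}\setminus N_v$. A local solution is a solution of the form $\sigma_S$ where $S$ assigns each variable $X$ a set $S_X\subseteq\mathsf{At_{nv}}$, the transitive closure of "$Y$ occurs in an atom of $S_X$" is irreflexive, and $\sigma_S(X):=\sigma_S(D_1)\sqcap\dots\sqcap\sigma_S(D_k)$ for $S_X=\{D_1,\dots,D_k\}$ ($\top$ if empty). $\mathsf{Cl}(\Gamma)$ is the clause set over propositional variables $[C\sqsubseteq D]$ ($C,D\in\mathsf{At}$), $[X>Y]$ ($X,Y\in N_v$), $p_{C,X,D}$ ($C\in\mathsf{At}$,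 $X\in N_v$, $D\in\mathsf{At_{nv}}$): (Ia) for each $C_1\sqcap\dots\sqcap C_n\sqsubseteq^? D$ in $\Gamma$ with $D\in\mathsf{At_{nv}}$: $[C_1\sqsubseteq D]\lor\dots\lor[C_n\sqsubseteq D]$; (Ib) for each $C_1\sqcap\dots\sqcap C_n\sqsubseteq^? X$ in $\Gamma$, $X\in N_v$, and $E\in\mathsf{At_{nv}}$: $[X\sqsubseteq E]\to[C_1\sqsubseteq E]\lor\dots\lor[C_n\sqsubseteq E]$; (Ic) for each $X\not\sqsubseteq^? Y$ in $\Gamma$: $\lnot[X\sqsubseteq Y]$; (IIa) $[A\sqsubseteq A]$ for $A\in N_c$; (IIb) $\lnot[A\sqsubseteq B]$ for distinct $A,B\in N_c$; (IIc) $\lnot[\exists r.A\sqsubseteq\exists s.B]$ for $\exists r.A,\exists s.B\in\mathsf{At_{nv}}$, $r\ne s$; (IId) $\lnot[A\sqsubseteq\exists r.B]$ and $\lnot[\exists r.B\sqsubseteq A]$ for $A\in N_c$, $\exists r.B\in\mathsf{At_{nv}}$; (IIe) $[\exists r.A\sqsubseteq\exists r.B]\to[A\sqsubseteq B]$ and $[A\sqsubseteq B]\to[\exists r.A\sqsubseteq\exists r.B]$; (III) $[C_1\sqsubseteq C_2]\land[C_2\sqsubseteq C_3]\to[C_1\sqsubseteq C_3]$ for $C_1,C_2,C_3\in\mathsf{At}$; (IV) for $C\in\mathsf{At}$, $X\in N_v$: $[C\sqsubseteq X]\lor\bigvee_{D\in\mathsf{At_{nv}}}p_{C,X,D}$,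 and for each $D\in\mathsf{At_{nv}}$: $p_{C,X,D}\to[X\sqsubseteq D]$ and $\lnot(p_{C,X,D}\land[C\sqsubseteq D])$; (Va) $\lnot[X>X]$; (Vb) $[X>Y]\land[Y>Z]\to[X>Z]$; (Vc) $[X\sqsubseteq\exists r.Y]\to[X>Y]$ for $X,Y\in N_v$ with $\exists r.Y\in\mathsf{At}$. -}

module Defs where

open import Data.Nat using (ℕ)
open import Data.Nat.Properties using (_≟_)
open import Data.Bool using (Bool; true; false)
open import Data.Unit using (⊤)
open import Data.Empty using (⊥)
open import Data.Product using (Σ; _×_; _,_)
open import Data.List using (List; []; _∷_; _++_; map; concatMap)
open import Data.List.NonEmpty using (List⁺) renaming (toList to toList⁺)
open import Data.List.Membership.Propositional using (_∈_)
open import Data.List.Relation.Binary.Subset.Propositional using (_⊆_)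
open import Data.List.Relation.Unary.All using (All)
open import Data.List.Relation.Unary.Any using (Any)
open import Relation.Nullary using (¬_; yes; no)
open import Relation.Binary.PropositionalEquality using (_≡_)
open import Relation.Binary.Construct.Closure.Transitive using (TransClosure)

data Name : Set where
  var : ℕ → Name
  con : ℕ → Name

data Concept : Set where
  ⊤c   : Concept
  name : Name → Concept
  _⊓_  : Concept → Concept → Concept
  ∃c   : ℕ → Concept → Concept

data Ground : Concept → Set where
  ⊤g   : Ground ⊤c
  cong : ∀ a → Ground (name (con a))
  ⊓g   : ∀ {C D} → Ground C → Ground D → Ground (C ⊓ D)
  ∃g   : ∀ {r C} → Ground C → Ground (∃c r C)

record Interpretation : Set₁ where
  field
    Δ    : Set
    varI : ℕ → Δ → Set
    conI : ℕ → Δ → Set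
    rolI : ℕ → Δ → Δ → Set

⟦_⟧ : Concept → (I : Interpretation) → Interpretation.Δ I → Set
⟦ ⊤c ⟧ I d = ⊤
⟦ name (var x) ⟧ I d = Interpretation.varI I x d
⟦ name (con a) ⟧ I d = Interpretation.conI I a d
⟦ C ⊓ D ⟧ I d = ⟦ C ⟧ I d × ⟦ D ⟧ I d
⟦ ∃c r C ⟧ I d = Σ (Interpretation.Δ I) λ e → Interpretation.rolI I r d e × ⟦ C ⟧ I e

_⊑_ : Concept → Concept → Set₁
C ⊑ D = (I : Interpretation) (d : Interpretation.Δ I) → ⟦ C ⟧ I d → ⟦ D ⟧ I d

data FAtom : Set where
  atom : Name → FAtom
  ex   : ℕ → Name → FAtom

⌜_⌝ : FAtom → Concept
⌜ atom A ⌝ = name A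
⌜ ex r A ⌝ = ∃c r (name A)

⨅ : List Concept → Concept
⨅ [] = ⊤c
⨅ (C ∷ []) = C
⨅ (C ∷ Cs@(_ ∷ _)) = C ⊓ ⨅ Cs

record Subsumption : Set where
  constructor _⊑?_
  field
    lhs : List⁺ FAtom
    rhs : FAtom

-- dissubsumption  X ⋢? Y  between variables X, Y
record Dissubsumption : Set where
  constructor _⋢?_
  field
    dl : ℕ
    dr : ℕ

record Problem : Set where
  field
    subs : List Subsumption
    diss : List Dissubsumption
open Problem

subAtoms : FAtom → List FAtom
subAtoms (atom A) = atom A ∷ []
subAtoms (ex r A) = ex r A ∷ atom A ∷ []

At : Problem → List FAtom
At Γ = concatMap (λ s → concatMap subAtoms (toList⁺ (Subsumption.lhs s) ++ (Subsumption.rhs s ∷ [])))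
                 (subs Γ)
    ++ concatMap (λ d → atom (var (Dissubsumption.dl d)) ∷ atom (var (Dissubsumption.dr d)) ∷ [])
                 (diss Γ)

isVar : FAtom → Bool
isVar (atom (var _)) = true
isVar _ = false

nonVar : List FAtom → List FAtom
nonVar [] = []
nonVar (a ∷ as) with isVar a
... | true = nonVar as
... | false = a ∷ nonVar as

Atnv : Problem → List FAtom
Atnv Γ = nonVar (At Γ)

varsOf : List FAtom → List ℕ
varsOf [] = []
varsOf (atom (var x) ∷ as) = x ∷ varsOf as
varsOf (_ ∷ as) = varsOf as

constsOf : List FAtom → List ℕ
constsOf [] = []
constsOf (atom (con a) ∷ as) = a ∷ constsOf as
constsOf (_ ∷ as) = constsOf as

Nv : Problem → List ℕ
Nv Γ = varsOf (At Γ)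

Nc : Problem → List ℕ
Nc Γ = constsOf (At Γ)

applyN : (ℕ → Concept) → Name → Concept
applyN σ (var x) = σ x
applyN σ (con a) = name (con a)

apply : (ℕ → Concept) → Concept → Concept
apply σ ⊤c = ⊤c
apply σ (name A) = applyN σ A
apply σ (C ⊓ D) = apply σ C ⊓ apply σ D
apply σ (∃c r C) = ∃c r (apply σ C)

IsSolution : Problem → (ℕ → Concept) → Set₁
IsSolution Γ σ =
    (∀ X → X ∈ Nv Γ → Ground (σ X))
  × All (λ s → apply σ (⨅ (map ⌜_⌝ (toList⁺ (Subsumption.lhs s))))
               ⊑ apply σ ⌜ Subsumption.rhs s ⌝) (subs Γ)
  × All (λ d → ¬ (σ (Dissubsumption.dl d) ⊑ σ (Dissubsumption.dr d))) (diss Γ)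

Occurs : (ℕ → List FAtom) → ℕ → ℕ → Set
Occurs S X Y = Σ ℕ λ r → ex r (var Y) ∈ S X

IsAcyclicAssignment : Problem → (ℕ → List FAtom) → Set
IsAcyclicAssignment Γ S =
    (∀ X → X ∈ Nv Γ → S X ⊆ Atnv Γ)
  × (∀ X → X ∈ Nv Γ → ¬ TransClosure (Occurs S) X X)

IsInducedBy : Problem → (ℕ → List FAtom) → (ℕ → Concept) → Set
IsInducedBy Γ S σ = ∀ X → X ∈ Nv Γ → σ X ≡ ⨅ (map (λ D → apply σ ⌜ D ⌝) (S X))

HasLocalSolution : Problem → Set₁
HasLocalSolution Γ =
  Σ (ℕ → List FAtom) λ S → Σ (ℕ → Concept) λ σ →
    IsAcyclicAssignment Γ S × IsInducedBy Γ S σ × IsSolution Γ σ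

data PVar : Set where
  [_⊑_] : FAtom → FAtom → PVar
  [_>_] : ℕ → ℕ → PVar
  p     : FAtom → ℕ → FAtom → PVar

data Literal : Set where
  +_ : PVar → Literal
  -_ : PVar → Literal

Clause : Set
Clause = List Literal

litTrue : (PVar → Bool) → Literal → Set
litTrue v (+ x) = v x ≡ true
litTrue v (- x) = v x ≡ false

Satisfiable : List Clause → Set
Satisfiable cs = Σ (PVar → Bool) λ v → All (λ c → Any (litTrue v) c) cs

X̂ : ℕ → FAtom
X̂ X = atom (var X)

module _ (Γ : Problem) where
  private
    at  = At Γ
    anv = Atnv Γ
    nv  = Nv Γ
    nc  = Nc Γ
    exs : List (ℕ × Name)
    exs = concatMap (λ { (ex r A) → (r , A) ∷ [] ; (atom _) → [] }) anv

  clI : List Clause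
  clI =
       concatMap (λ s → ia (toList⁺ (Subsumption.lhs s)) (Subsumption.rhs s)) (subs Γ)
    ++ concatMap (λ s → ib (toList⁺ (Subsumption.lhs s)) (Subsumption.rhs s)) (subs Γ)
    ++ map (λ d → (- [ X̂ (Dissubsumption.dl d) ⊑ X̂ (Dissubsumption.dr d) ]) ∷ []) (diss Γ)
    where
    ia : List FAtom → FAtom → List Clause
    ia Cs (atom (var X)) = []
    ia Cs D = map (λ C → + [ C ⊑ D ]) Cs ∷ []
    ib : List FAtom → FAtom → List Clause
    ib Cs (atom (var X)) = map (λ E → (- [ X̂ X ⊑ E ]) ∷ map (λ C → + [ C ⊑ E ]) Cs) anv
    ib Cs D = []

  clII : List Clause
  clII =
       map (λ A → (+ [ atom (con A) ⊑ atom (con A) ]) ∷ []) nc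
    ++ concatMap (λ A → concatMap (λ B → distinct A B) nc) nc
    ++ concatMap (λ { (r , A) → concatMap (λ { (s , B) → c2 r A s B }) exs }) exs
    ++ concatMap (λ A → concatMap (λ { (r , B) →
           ((- [ atom (con A) ⊑ ex r B ]) ∷ []) ∷ ((- [ ex r B ⊑ atom (con A) ]) ∷ []) ∷ [] }) exs) nc
    where
    distinct : ℕ → ℕ → List Clause
    distinct A B with A ≟ B
    ... | yes _ = []
    ... | no _  = ((- [ atom (con A) ⊑ atom (con B) ]) ∷ []) ∷ []
    c2 : ℕ → Name → ℕ → Name → List Clause
    c2 r A s B with r ≟ s
    ... | no _  = ((- [ ex r A ⊑ ex s B ]) ∷ []) ∷ []
    ... | yes _ = ((- [ ex r A ⊑ ex r B ]) ∷ (+ [ atom A ⊑ atom B ]) ∷ [])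
                ∷ ((- [ atom A ⊑ atom B ]) ∷ (+ [ ex r A ⊑ ex r B ]) ∷ [])
                ∷ []

  clIII : List Clause
  clIII = concatMap (λ C₁ → concatMap (λ C₂ → map (λ C₃ →
            (- [ C₁ ⊑ C₂ ]) ∷ (- [ C₂ ⊑ C₃ ]) ∷ (+ [ C₁ ⊑ C₃ ]) ∷ []) at) at) at

  clIV : List Clause
  clIV = concatMap (λ C → concatMap (λ X →
             ((+ [ C ⊑ X̂ X ]) ∷ map (λ D → + p C X D) anv)
           ∷ concatMap (λ D → ((- p C X D) ∷ (+ [ X̂ X ⊑ D ]) ∷ [])
                            ∷ ((- p C X D) ∷ (- [ C ⊑ D ]) ∷ []) ∷ []) anv) nv) at

  clV : List Clause
  clV = map (λ X → (- [ X > X ]) ∷ []) nv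
     ++ concatMap (λ X → concatMap (λ Y → map (λ Z →
          (- [ X > Y ]) ∷ (- [ Y > Z ]) ∷ (+ [ X > Z ]) ∷ []) nv) nv) nv
     ++ concatMap (λ X → concatMap (λ { (r , var Y) → ((- [ X̂ X ⊑ ex r (var Y) ]) ∷ (+ [ X > Y ]) ∷ []) ∷ []
                                      ; (r , con _) → [] }) exs) nv

  Cl : List Clause
  Cl = clI ++ clII ++ clIII ++ clIV ++ clV

module Submission where

open import Defs
open Problem

open import Data.Bool using (Bool; true; false)
open import Data.Bool.Properties using (not-¬) renaming (_≟_ to _≟ᵇ_)
open import Data.Empty using (⊥-elim)
open import Data.List using (List; []; _∷_; _++_; map; concatMap; filter; length)
open import Data.List.Membership.Propositional using (_∈_; find; lose)
open import Data.List.Membership.Propositional.Properties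
  using (∈-filter⁺; ∈-filter⁻; ∈-++⁺ˡ; ∈-++⁺ʳ; ∈-++⁻; ∈-map⁺; ∈-map⁻; ∈-concatMap⁺; ∈-concatMap⁻)
open import Data.List.NonEmpty using () renaming (toList to toList⁺)
open import Data.List.Properties using (map-cong-local; map-∘; length-filter)
open import Data.List.Relation.Binary.Subset.Propositional using (_⊆_)
open import Data.List.Relation.Unary.All as All using (All; []; _∷_)
import Data.List.Relation.Unary.All.Properties as Allₚ
open import Data.List.Relation.Unary.Any as Any using (Any; here; there)
import Data.List.Relation.Unary.Any.Properties as Anyₚ
open import Data.Nat using (ℕ; zero; suc; _+_; _≤_; _<_; _<?_; _⊔_; z≤n; s≤s)
import Data.Nat.Properties as ℕ
import Data.Product as Product
open import Data.Product using (_×_; _,_; proj₁; proj₂; ∃-syntax)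
open import Data.Sum as Sum using (_⊎_; inj₁; inj₂)
open import Data.Unit using (tt) renaming (⊤ to Unit)
open import Function.Base using (_∘_)
open import Function.Bundles using (_⇔_; mk⇔; Equivalence)
open import Relation.Binary.Construct.Closure.Transitive
  using (TransClosure) renaming ([_] to [_]⁺; _∷_ to _∷⁺_)
open import Relation.Binary.Definitions using (DecidableEquality)
open import Relation.Binary.PropositionalEquality as ≡ using (_≡_; refl)
open import Relation.Nullary using (¬_; Dec; yes; no; does; ¬?)
open import Relation.Nullary.Decidable using (map′; _×-dec_; _⊎-dec_; dec-true; dec-false)
open import Relation.Unary using (Decidable)

-- Subsumption between EL concepts is structural (read off in the canonical model), hence
-- decidable, and a conjunction lies below a name or an existential only if one of its
-- conjuncts does.
--
-- Given a local solution σ_S, read [C ⊑ D] as σ(C) ⊑ σ(D), [X > Y] as "σ(Y) has smaller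
-- role depth than σ(X)" and p_{C,X,D} as "D ∈ S_X and σ(C) ⋢ σ(D)"; every clause of Cl(Γ)
-- is then a valid fact about EL subsumption.
--
-- Conversely, given a satisfying valuation put S_X = {D ∈ At_nv | [X ⊑ D]}.  Clauses (V)
-- make > a strict order that contains the occurrence relation of S, so S is acyclic and
-- σ_S exists.  An induction on a measure that decreases from X to the atoms of S_X and
-- from ∃r.A to A shows that [C ⊑ D] holds exactly when σ_S(C) ⊑ σ_S(D); for a variable
-- X on the right, clause (III) propagates [C ⊑ X] to every atom of S_X and clause (IV)
-- supplies an atom of S_X witnessing its failure.  Clauses (I) then become the
-- subsumptions and dissubsumptions of Γ.

module _ {A B : Set} {f : A → List B} where

  ∈-concatMap-intro : ∀ xs {x y} → x ∈ xs → y ∈ f x → y ∈ concatMap f xs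
  ∈-concatMap-intro xs x∈ y∈ = ∈-concatMap⁺ f (lose x∈ y∈)

  ∈-concatMap-elim : ∀ xs {y} → y ∈ concatMap f xs → ∃[ x ] x ∈ xs × y ∈ f x
  ∈-concatMap-elim xs y∈ = find (∈-concatMap⁻ f y∈)

module _ {A B : Set} {ℓ} {P : B → Set ℓ} {f : A → List B} where

  All-concatMap⁻ : ∀ xs → All P (concatMap f xs) → ∀ {x} → x ∈ xs → All P (f x)
  All-concatMap⁻ xs Pfxs = All.lookup (Allₚ.map⁻ (Allₚ.concat⁻ Pfxs))

module _ {A : Set} {P Q : A → Set} (P? : Decidable P) (Q? : Decidable Q) where

  length-filter-mono : ∀ xs → (∀ {x} → x ∈ xs → P x → Q x) → length (filter P? xs) ≤ length (filter Q? xs)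
  length-filter-mono []       _   = z≤n
  length-filter-mono (x ∷ xs) P⇒Q with P? x | Q? x
  ... | yes _  | yes _  = s≤s (length-filter-mono xs (P⇒Q ∘ there))
  ... | yes Px | no ¬Qx = ⊥-elim (¬Qx (P⇒Q (here refl) Px))
  ... | no _   | yes _  = ℕ.m≤n⇒m≤1+n (length-filter-mono xs (P⇒Q ∘ there))
  ... | no _   | no _   = length-filter-mono xs (P⇒Q ∘ there)

  length-filter-strict : ∀ xs → (∀ {x} → x ∈ xs → P x → Q x) →
                         ∀ {y} → y ∈ xs → Q y → ¬ P y → length (filter P? xs) < length (filter Q? xs)
  length-filter-strict (x ∷ xs) P⇒Q (here refl) Qy ¬Py with P? x | Q? x
  ... | yes Py | _      = ⊥-elim (¬Py Py)
  ... | no _   | no ¬Qy = ⊥-elim (¬Qy Qy)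
  ... | no _   | yes _  = s≤s (length-filter-mono xs (P⇒Q ∘ there))
  length-filter-strict (x ∷ xs) P⇒Q (there y∈) Qy ¬Py with P? x | Q? x
  ... | yes _  | yes _  = s≤s (length-filter-strict xs (P⇒Q ∘ there) y∈ Qy ¬Py)
  ... | yes Px | no ¬Qx = ⊥-elim (¬Qx (P⇒Q (here refl) Px))
  ... | no _   | yes _  = ℕ.m≤n⇒m≤1+n (length-filter-strict xs (P⇒Q ∘ there) y∈ Qy ¬Py)
  ... | no _   | no _   = length-filter-strict xs (P⇒Q ∘ there) y∈ Qy ¬Py

does≡true⇒ : ∀ {ℓ} {A : Set ℓ} (a? : Dec A) → does a? ≡ true → A
does≡true⇒ (yes a) _ = a

-- Structural subsumption in EL

infix 4 _∈⊓_ _⊑ₛ_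

data _∈⊓_ : Concept → Concept → Set where
  name-self : ∀ {A} → name A ∈⊓ name A
  ∃-self    : ∀ {r C} → ∃c r C ∈⊓ ∃c r C
  ⊓ˡ        : ∀ {E C D} → E ∈⊓ C → E ∈⊓ C ⊓ D
  ⊓ʳ        : ∀ {E C D} → E ∈⊓ D → E ∈⊓ C ⊓ D

_⊑ₛ_ : Concept → Concept → Set
C ⊑ₛ ⊤c      = Unit
C ⊑ₛ name A  = name A ∈⊓ C
C ⊑ₛ D₁ ⊓ D₂ = C ⊑ₛ D₁ × C ⊑ₛ D₂
C ⊑ₛ ∃c r D  = ∃[ C' ] ∃c r C' ∈⊓ C × C' ⊑ₛ D

⊑ₛ-weaken : ∀ {C C'} → (∀ {E} → E ∈⊓ C → E ∈⊓ C') → ∀ D → C ⊑ₛ D → C' ⊑ₛ D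
⊑ₛ-weaken f ⊤c       _              = tt
⊑ₛ-weaken f (name A) e              = f e
⊑ₛ-weaken f (D₁ ⊓ D₂) (s₁ , s₂)     = ⊑ₛ-weaken f D₁ s₁ , ⊑ₛ-weaken f D₂ s₂
⊑ₛ-weaken f (∃c r D) (C' , e , s)   = C' , f e , s

⊑ₛ-refl : ∀ C → C ⊑ₛ C
⊑ₛ-refl ⊤c       = tt
⊑ₛ-refl (name A) = name-self
⊑ₛ-refl (C ⊓ D)  = ⊑ₛ-weaken ⊓ˡ C (⊑ₛ-refl C) , ⊑ₛ-weaken ⊓ʳ D (⊑ₛ-refl D)
⊑ₛ-refl (∃c r C) = C , ∃-self , ⊑ₛ-refl C

-- Elements are concepts, and C lies in the extension of D exactly when C ⊑ₛ D;
-- evaluating a subsumption C ⊑ D at the element C itself therefore yields C ⊑ₛ D.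
canonical : Interpretation
canonical = record
  { Δ    = Concept
  ; varI = λ x C → name (var x) ∈⊓ C
  ; conI = λ a C → name (con a) ∈⊓ C
  ; rolI = λ r C C' → ∃c r C' ∈⊓ C
  }

canonical⇒⊑ₛ : ∀ D {C} → ⟦ D ⟧ canonical C → C ⊑ₛ D
canonical⇒⊑ₛ ⊤c             _              = tt
canonical⇒⊑ₛ (name (var x)) e              = e
canonical⇒⊑ₛ (name (con a)) e              = e
canonical⇒⊑ₛ (D₁ ⊓ D₂)      (d₁ , d₂)      = canonical⇒⊑ₛ D₁ d₁ , canonical⇒⊑ₛ D₂ d₂
canonical⇒⊑ₛ (∃c r D)       (C' , e , d)   = C' , e , canonical⇒⊑ₛ D d

⊑ₛ⇒canonical : ∀ D {C} → C ⊑ₛ D → ⟦ D ⟧ canonical C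
⊑ₛ⇒canonical ⊤c             _              = tt
⊑ₛ⇒canonical (name (var x)) e              = e
⊑ₛ⇒canonical (name (con a)) e              = e
⊑ₛ⇒canonical (D₁ ⊓ D₂)      (s₁ , s₂)      = ⊑ₛ⇒canonical D₁ s₁ , ⊑ₛ⇒canonical D₂ s₂
⊑ₛ⇒canonical (∃c r D)       (C' , e , s)   = C' , e , ⊑ₛ⇒canonical D s

⊑⇒⊑ₛ : ∀ C D → C ⊑ D → C ⊑ₛ D
⊑⇒⊑ₛ C D C⊑D = canonical⇒⊑ₛ D (C⊑D canonical C (⊑ₛ⇒canonical C (⊑ₛ-refl C)))

∈⊓⇒⊑ : ∀ {E C} → E ∈⊓ C → C ⊑ E
∈⊓⇒⊑ name-self I d x       = x
∈⊓⇒⊑ ∃-self    I d x       = x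
∈⊓⇒⊑ (⊓ˡ e)    I d (x , _) = ∈⊓⇒⊑ e I d x
∈⊓⇒⊑ (⊓ʳ e)    I d (_ , y) = ∈⊓⇒⊑ e I d y

⊑ₛ⇒⊑ : ∀ {C} D → C ⊑ₛ D → C ⊑ D
⊑ₛ⇒⊑ ⊤c        _            I d x = tt
⊑ₛ⇒⊑ (name A)  e            I d x = ∈⊓⇒⊑ e I d x
⊑ₛ⇒⊑ (D₁ ⊓ D₂) (s₁ , s₂)    I d x = ⊑ₛ⇒⊑ D₁ s₁ I d x , ⊑ₛ⇒⊑ D₂ s₂ I d x
⊑ₛ⇒⊑ (∃c r D)  (C' , e , s) I d x with ∈⊓⇒⊑ e I d x
... | d' , rdd' , x' = d' , rdd' , ⊑ₛ⇒⊑ D s I d' x'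

_≟ₙ_ : DecidableEquality Name
var x ≟ₙ var y = map′ (≡.cong var) (λ { refl → refl }) (x ℕ.≟ y)
con a ≟ₙ con b = map′ (≡.cong con) (λ { refl → refl }) (a ℕ.≟ b)
var _ ≟ₙ con _ = no λ ()
con _ ≟ₙ var _ = no λ ()

name-∈⊓? : ∀ A C → Dec (name A ∈⊓ C)
name-∈⊓? A ⊤c        = no λ ()
name-∈⊓? A (name B)  = map′ (λ { refl → name-self }) (λ { name-self → refl }) (B ≟ₙ A)
name-∈⊓? A (C₁ ⊓ C₂) = map′ Sum.[ ⊓ˡ , ⊓ʳ ] (λ { (⊓ˡ e) → inj₁ e ; (⊓ʳ e) → inj₂ e })
                            (name-∈⊓? A C₁ ⊎-dec name-∈⊓? A C₂)
name-∈⊓? A (∃c r C)  = no λ ()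

∃-∈⊓? : ∀ r {D} → (∀ C' → Dec (C' ⊑ₛ D)) → ∀ C → Dec (∃[ C' ] ∃c r C' ∈⊓ C × C' ⊑ₛ D)
∃-∈⊓? r _⊑ₛD? ⊤c        = no λ { (_ , () , _) }
∃-∈⊓? r _⊑ₛD? (name A)  = no λ { (_ , () , _) }
∃-∈⊓? r _⊑ₛD? (C₁ ⊓ C₂) =
  map′ Sum.[ (λ { (C' , e , s) → C' , ⊓ˡ e , s }) , (λ { (C' , e , s) → C' , ⊓ʳ e , s }) ]
       (λ { (C' , ⊓ˡ e , s) → inj₁ (C' , e , s) ; (C' , ⊓ʳ e , s) → inj₂ (C' , e , s) })
       (∃-∈⊓? r _⊑ₛD? C₁ ⊎-dec ∃-∈⊓? r _⊑ₛD? C₂)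
∃-∈⊓? r _⊑ₛD? (∃c s C)  =
  map′ (λ { (refl , C⊑ₛD) → C , ∃-self , C⊑ₛD }) (λ { (_ , ∃-self , C⊑ₛD) → refl , C⊑ₛD })
       (s ℕ.≟ r ×-dec C ⊑ₛD?)

_⊑ₛ?_ : ∀ C D → Dec (C ⊑ₛ D)
C ⊑ₛ? ⊤c        = yes tt
C ⊑ₛ? name A    = name-∈⊓? A C
C ⊑ₛ? (D₁ ⊓ D₂) = C ⊑ₛ? D₁ ×-dec C ⊑ₛ? D₂
C ⊑ₛ? ∃c r D    = ∃-∈⊓? r (_⊑ₛ? D) C

⊑-dec : ∀ C D → Dec (C ⊑ D)
⊑-dec C D = map′ (⊑ₛ⇒⊑ D) (⊑⇒⊑ₛ C D) (C ⊑ₛ? D)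

⊑-refl : ∀ C → C ⊑ C
⊑-refl C I d x = x

⊑-trans : ∀ C D E → C ⊑ D → D ⊑ E → C ⊑ E
⊑-trans C D E C⊑D D⊑E I d x = D⊑E I d (C⊑D I d x)

∃-mono : ∀ r C D → C ⊑ D → ∃c r C ⊑ ∃c r D
∃-mono r C D C⊑D I d (d' , rdd' , x) = d' , rdd' , C⊑D I d' x

name-⊑-injective : ∀ A B → name A ⊑ name B → A ≡ B
name-⊑-injective A B A⊑B with ⊑⇒⊑ₛ (name A) (name B) A⊑B
... | name-self = refl

∃-⊑-role : ∀ {r s} C D → ∃c r C ⊑ ∃c s D → r ≡ s
∃-⊑-role {r} {s} C D r⊑s with ⊑⇒⊑ₛ (∃c r C) (∃c s D) r⊑s
... | _ , ∃-self , _ = refl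

∃-⊑-cancel : ∀ r C D → ∃c r C ⊑ ∃c r D → C ⊑ D
∃-⊑-cancel r C D r⊑r with ⊑⇒⊑ₛ (∃c r C) (∃c r D) r⊑r
... | _ , ∃-self , C⊑ₛD = ⊑ₛ⇒⊑ D C⊑ₛD

name⋢∃ : ∀ A r C → ¬ (name A ⊑ ∃c r C)
name⋢∃ A r C A⊑∃ with ⊑⇒⊑ₛ (name A) (∃c r C) A⊑∃
... | _ , () , _

∃⋢name : ∀ r C A → ¬ (∃c r C ⊑ name A)
∃⋢name r C A ∃⊑A with ⊑⇒⊑ₛ (∃c r C) (name A) ∃⊑A
... | ()

data Atomic : Concept → Set where
  name : ∀ A → Atomic (name A)
  ∃c   : ∀ r C → Atomic (∃c r C)

⌜⌝-atomic : ∀ τ D → isVar D ≡ false → Atomic (apply τ ⌜ D ⌝)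
⌜⌝-atomic τ (atom (con a)) _ = name (con a)
⌜⌝-atomic τ (ex r A)       _ = ∃c r (applyN τ A)

⨅-lower : ∀ {D} Ds → D ∈ Ds → ⨅ Ds ⊑ D
⨅-lower (D ∷ [])      (here refl) I d x       = x
⨅-lower (D ∷ _ ∷ _)   (here refl) I d (x , _) = x
⨅-lower (_ ∷ D' ∷ Ds) (there D∈)  I d (_ , x) = ⨅-lower (D' ∷ Ds) D∈ I d x

⨅-greatest : ∀ C Ds → All (C ⊑_) Ds → C ⊑ ⨅ Ds
⨅-greatest C []            []           I d x = tt
⨅-greatest C (D ∷ [])      (C⊑D ∷ [])   = C⊑D
⨅-greatest C (D ∷ D' ∷ Ds) (C⊑D ∷ C⊑Ds) I d x = C⊑D I d x , ⨅-greatest C (D' ∷ Ds) C⊑Ds I d x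

∈⊓-⨅ : ∀ {E} Ds → E ∈⊓ ⨅ Ds → Any (E ∈⊓_) Ds
∈⊓-⨅ (D ∷ [])      e      = here e
∈⊓-⨅ (D ∷ _ ∷ _)   (⊓ˡ e) = here e
∈⊓-⨅ (_ ∷ D' ∷ Ds) (⊓ʳ e) = there (∈⊓-⨅ (D' ∷ Ds) e)

⨅-⊑-atomic : ∀ {E} → Atomic E → ∀ Ds → ⨅ Ds ⊑ E → Any (_⊑ E) Ds
⨅-⊑-atomic (name A) Ds ⨅⊑A = Any.map ∈⊓⇒⊑ (∈⊓-⨅ Ds (⊑⇒⊑ₛ (⨅ Ds) (name A) ⨅⊑A))
⨅-⊑-atomic (∃c r C) Ds ⨅⊑∃ with ⊑⇒⊑ₛ (⨅ Ds) (∃c r C) ⨅⊑∃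
... | C' , e , C'⊑ₛC = Any.map (λ e' → ⊑ₛ⇒⊑ (∃c r C) (C' , e' , C'⊑ₛC)) (∈⊓-⨅ Ds e)

depth : Concept → ℕ
depth ⊤c       = 0
depth (name _) = 0
depth (C ⊓ D)  = depth C ⊔ depth D
depth (∃c r C) = suc (depth C)

∈⊓-depth : ∀ {E C} → E ∈⊓ C → depth E ≤ depth C
∈⊓-depth name-self          = ℕ.≤-refl
∈⊓-depth ∃-self             = ℕ.≤-refl
∈⊓-depth (⊓ˡ {C = C} {D} e) = ℕ.m≤n⇒m≤n⊔o (depth D) (∈⊓-depth e)
∈⊓-depth (⊓ʳ {C = C} {D} e) = ℕ.m≤n⇒m≤o⊔n (depth C) (∈⊓-depth e)

⊑ₛ-depth : ∀ {C} D → C ⊑ₛ D → depth D ≤ depth C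
⊑ₛ-depth ⊤c        _            = z≤n
⊑ₛ-depth (name A)  _            = z≤n
⊑ₛ-depth (D₁ ⊓ D₂) (s₁ , s₂)    = ℕ.⊔-lub (⊑ₛ-depth D₁ s₁) (⊑ₛ-depth D₂ s₂)
⊑ₛ-depth (∃c r D)  (C' , e , s) = ℕ.≤-trans (s≤s (⊑ₛ-depth D s)) (∈⊓-depth e)

⊑∃⇒depth< : ∀ C r D → C ⊑ ∃c r D → depth D < depth C
⊑∃⇒depth< C r D C⊑∃ = ⊑ₛ-depth (∃c r D) (⊑⇒⊑ₛ C (∃c r D) C⊑∃)

apply-⨅ : ∀ σ Cs → apply σ (⨅ Cs) ≡ ⨅ (map (apply σ) Cs)
apply-⨅ σ []            = refl
apply-⨅ σ (C ∷ [])      = refl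
apply-⨅ σ (C ∷ C' ∷ Cs) = ≡.cong (apply σ C ⊓_) (apply-⨅ σ (C' ∷ Cs))

apply-⨅-⌜⌝ : ∀ σ Cs → apply σ (⨅ (map ⌜_⌝ Cs)) ≡ ⨅ (map (λ C → apply σ ⌜ C ⌝) Cs)
apply-⨅-⌜⌝ σ Cs = ≡.trans (apply-⨅ σ (map ⌜_⌝ Cs)) (≡.cong ⨅ (≡.sym (map-∘ Cs)))

⨅-ground : ∀ {Cs} → All Ground Cs → Ground (⨅ Cs)
⨅-ground []              = ⊤g
⨅-ground (g ∷ [])        = g
⨅-ground (g ∷ gs@(_ ∷ _)) = ⊓g g (⨅-ground gs)

_≟ᶠ_ : DecidableEquality FAtom
atom A ≟ᶠ atom B = map′ (≡.cong atom) (λ { refl → refl }) (A ≟ₙ B)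
ex r A ≟ᶠ ex s B = map′ (λ { (refl , refl) → refl }) (λ { refl → refl , refl }) (r ℕ.≟ s ×-dec A ≟ₙ B)
atom _ ≟ᶠ ex _ _ = no λ ()
ex _ _ ≟ᶠ atom _ = no λ ()

open import Data.List.Membership.DecPropositional _≟ᶠ_ using (_∈?_)

∈-varsOf⁺ : ∀ {X} L → atom (var X) ∈ L → X ∈ varsOf L
∈-varsOf⁺ (atom (var _) ∷ L) (here refl) = here refl
∈-varsOf⁺ (atom (var _) ∷ L) (there X∈)  = there (∈-varsOf⁺ L X∈)
∈-varsOf⁺ (atom (con _) ∷ L) (there X∈)  = ∈-varsOf⁺ L X∈
∈-varsOf⁺ (ex _ _ ∷ L)       (there X∈)  = ∈-varsOf⁺ L X∈

∈-varsOf⁻ : ∀ {X} L → X ∈ varsOf L → atom (var X) ∈ L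
∈-varsOf⁻ (atom (var _) ∷ L) (here refl) = here refl
∈-varsOf⁻ (atom (var _) ∷ L) (there X∈)  = there (∈-varsOf⁻ L X∈)
∈-varsOf⁻ (atom (con _) ∷ L) X∈          = there (∈-varsOf⁻ L X∈)
∈-varsOf⁻ (ex _ _ ∷ L)       X∈          = there (∈-varsOf⁻ L X∈)

∈-constsOf⁺ : ∀ {a} L → atom (con a) ∈ L → a ∈ constsOf L
∈-constsOf⁺ (atom (con _) ∷ L) (here refl) = here refl
∈-constsOf⁺ (atom (con _) ∷ L) (there a∈)  = there (∈-constsOf⁺ L a∈)
∈-constsOf⁺ (atom (var _) ∷ L) (there a∈)  = ∈-constsOf⁺ L a∈
∈-constsOf⁺ (ex _ _ ∷ L)       (there a∈)  = ∈-constsOf⁺ L a∈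

∈-nonVar⁺ : ∀ {D} L → D ∈ L → isVar D ≡ false → D ∈ nonVar L
∈-nonVar⁺ (E ∷ L) (here refl) nv with isVar E
... | false = here refl
∈-nonVar⁺ (E ∷ L) (there D∈)  nv with isVar E
... | true  = ∈-nonVar⁺ L D∈ nv
... | false = there (∈-nonVar⁺ L D∈ nv)

∈-nonVar⁻ : ∀ {D} L → D ∈ nonVar L → D ∈ L × isVar D ≡ false
∈-nonVar⁻ (E ∷ L) D∈ with isVar E in eq
∈-nonVar⁻ (E ∷ L) D∈          | true  = Product.map₁ there (∈-nonVar⁻ L D∈)
∈-nonVar⁻ (E ∷ L) (here refl) | false = here refl , eq
∈-nonVar⁻ (E ∷ L) (there D∈)  | false = Product.map₁ there (∈-nonVar⁻ L D∈)

∈-subAtoms-self : ∀ C → C ∈ subAtoms C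
∈-subAtoms-self (atom _) = here refl
∈-subAtoms-self (ex _ _) = here refl

subAtoms-∃-closed : ∀ {r A} L → ex r A ∈ concatMap subAtoms L → atom A ∈ concatMap subAtoms L
subAtoms-∃-closed L ∃∈ with ∈-concatMap-elim L ∃∈
... | ex r A , C∈ , here refl        = ∈-concatMap-intro L C∈ (there (here refl))
... | ex r A , C∈ , there (here ())
... | atom _ , C∈ , here ()

module _ (Γ : Problem) where

  private
    subsumptionAtoms : List FAtom
    subsumptionAtoms =
      concatMap (λ s → concatMap subAtoms (toList⁺ (Subsumption.lhs s) ++ (Subsumption.rhs s ∷ []))) (subs Γ)

  At-∃-closed : ∀ {r A} → ex r A ∈ At Γ → atom A ∈ At Γ
  At-∃-closed ∃∈ with ∈-++⁻ subsumptionAtoms ∃∈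
  ... | inj₁ ∃∈ₛ with ∈-concatMap-elim (subs Γ) ∃∈ₛ
  ...   | Cs ⊑? D , s∈ , ∃∈s =
    ∈-++⁺ˡ (∈-concatMap-intro (subs Γ) s∈ (subAtoms-∃-closed (toList⁺ Cs ++ D ∷ []) ∃∈s))
  At-∃-closed ∃∈ | inj₂ ∃∈d with ∈-concatMap-elim (diss Γ) ∃∈d
  ... | _ , _ , here ()
  ... | _ , _ , there (here ())

  lhs∈At : ∀ {Cs D C} → (Cs ⊑? D) ∈ subs Γ → C ∈ toList⁺ Cs → C ∈ At Γ
  lhs∈At {Cs} {D} {C} s∈ C∈ = ∈-++⁺ˡ (∈-concatMap-intro (subs Γ) s∈
    (∈-concatMap-intro (toList⁺ Cs ++ D ∷ []) (∈-++⁺ˡ C∈) (∈-subAtoms-self C)))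

  rhs∈At : ∀ {Cs D} → (Cs ⊑? D) ∈ subs Γ → D ∈ At Γ
  rhs∈At {Cs} {D} s∈ = ∈-++⁺ˡ (∈-concatMap-intro (subs Γ) s∈
    (∈-concatMap-intro (toList⁺ Cs ++ D ∷ []) (∈-++⁺ʳ (toList⁺ Cs) (here refl)) (∈-subAtoms-self D)))

  dissˡ∈At : ∀ {X Y} → (X ⋢? Y) ∈ diss Γ → X̂ X ∈ At Γ
  dissˡ∈At d∈ = ∈-++⁺ʳ subsumptionAtoms (∈-concatMap-intro (diss Γ) d∈ (here refl))

  dissʳ∈At : ∀ {X Y} → (X ⋢? Y) ∈ diss Γ → X̂ Y ∈ At Γ
  dissʳ∈At d∈ = ∈-++⁺ʳ subsumptionAtoms (∈-concatMap-intro (diss Γ) d∈ (there (here refl)))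

infix 4 _⊨_

_⊨_ : (PVar → Bool) → Clause → Set
v ⊨ c = Any (litTrue v) c

module ClauseShapes (v : PVar → Bool) where

  ⊨-⇒⁺ : ∀ {a b} → (v a ≡ true → v b ≡ true) → v ⊨ (- a) ∷ (+ b) ∷ []
  ⊨-⇒⁺ {a} a⇒b with v a in va
  ... | true  = there (here (a⇒b refl))
  ... | false = here va

  ⊨-⇒⁻ : ∀ {a b} → v ⊨ (- a) ∷ (+ b) ∷ [] → v a ≡ true → v b ≡ true
  ⊨-⇒⁻ (here a-false)   a-true = ⊥-elim (not-¬ a-true a-false)
  ⊨-⇒⁻ (there (here b)) _      = b

  ⊨-nand⁺ : ∀ {a b} → (v a ≡ true → v b ≡ false) → v ⊨ (- a) ∷ (- b) ∷ []
  ⊨-nand⁺ {a} a⇒¬b with v a in va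
  ... | true  = there (here (a⇒¬b refl))
  ... | false = here va

  ⊨-nand⁻ : ∀ {a b} → v ⊨ (- a) ∷ (- b) ∷ [] → v a ≡ true → v b ≡ false
  ⊨-nand⁻ (here a-false)   a-true = ⊥-elim (not-¬ a-true a-false)
  ⊨-nand⁻ (there (here b)) _      = b

  ⊨-⇒₂⁺ : ∀ {a b c} → (v a ≡ true → v b ≡ true → v c ≡ true) → v ⊨ (- a) ∷ (- b) ∷ (+ c) ∷ []
  ⊨-⇒₂⁺ {a} {b} a⇒b⇒c with v a in va | v b in vb
  ... | true  | true  = there (there (here (a⇒b⇒c refl refl)))
  ... | true  | false = there (here vb)
  ... | false | _     = here va

  ⊨-⇒₂⁻ : ∀ {a b c} → v ⊨ (- a) ∷ (- b) ∷ (+ c) ∷ [] → v a ≡ true → v b ≡ true → v c ≡ true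
  ⊨-⇒₂⁻ (here a-false)           a-true _      = ⊥-elim (not-¬ a-true a-false)
  ⊨-⇒₂⁻ (there (here b-false))   _      b-true = ⊥-elim (not-¬ b-true b-false)
  ⊨-⇒₂⁻ (there (there (here c))) _      _      = c

module Induced (Γ : Problem) (S : ℕ → List FAtom) (σ : ℕ → Concept) (σ-induced : IsInducedBy Γ S σ) where

  induced-⊑ : ∀ {X D} → X ∈ Nv Γ → D ∈ S X → σ X ⊑ apply σ ⌜ D ⌝
  induced-⊑ {X} {D} X∈ D∈S =
    ≡.subst (_⊑ apply σ ⌜ D ⌝) (≡.sym (σ-induced X X∈))
      (⨅-lower (map (λ E → apply σ ⌜ E ⌝) (S X)) (∈-map⁺ _ D∈S))

  ⊑-induced : ∀ C {X} → X ∈ Nv Γ → All (λ D → C ⊑ apply σ ⌜ D ⌝) (S X) → C ⊑ σ X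
  ⊑-induced C {X} X∈ C⊑S =
    ≡.subst (C ⊑_) (≡.sym (σ-induced X X∈))
      (⨅-greatest C (map (λ E → apply σ ⌜ E ⌝) (S X)) (Allₚ.map⁺ C⊑S))

-- From a satisfying valuation to a local solution

module Satisfiable⇒LocalSolution (Γ : Problem) (v : PVar → Bool) (v⊨Cl : All (v ⊨_) (Cl Γ)) where

  open ClauseShapes v

  infix 4 _⊑ᵛ_ _⋢ᵛ_ _>ᵛ_

  _⊑ᵛ_ _⋢ᵛ_ : FAtom → FAtom → Set
  C ⊑ᵛ D = v [ C ⊑ D ] ≡ true
  C ⋢ᵛ D = v [ C ⊑ D ] ≡ false

  _>ᵛ_ : ℕ → ℕ → Set
  X >ᵛ Y = v [ X > Y ] ≡ true

  var∈Nv : ∀ {X} → X̂ X ∈ At Γ → X ∈ Nv Γ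
  var∈Nv = ∈-varsOf⁺ (At Γ)

  con∈Nc : ∀ {a} → atom (con a) ∈ At Γ → a ∈ Nc Γ
  con∈Nc = ∈-constsOf⁺ (At Γ)

  nonVar∈Atnv : ∀ {D} → D ∈ At Γ → isVar D ≡ false → D ∈ Atnv Γ
  nonVar∈Atnv = ∈-nonVar⁺ (At Γ)

  Atnv⊆At : ∀ {D} → D ∈ Atnv Γ → D ∈ At Γ
  Atnv⊆At = proj₁ ∘ ∈-nonVar⁻ (At Γ)

  ∃∈Atnv⇒∈Nv : ∀ {r Y} → ex r (var Y) ∈ Atnv Γ → Y ∈ Nv Γ
  ∃∈Atnv⇒∈Nv = ∈-varsOf⁺ (At Γ) ∘ At-∃-closed Γ ∘ Atnv⊆At

  private
    ⊨I : All (v ⊨_) (clI Γ)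
    ⊨I = Allₚ.++⁻ˡ (clI Γ) v⊨Cl

    ⊨II : All (v ⊨_) (clII Γ)
    ⊨II = Allₚ.++⁻ˡ (clII Γ) (Allₚ.++⁻ʳ (clI Γ) v⊨Cl)

    ⊨III : All (v ⊨_) (clIII Γ)
    ⊨III = Allₚ.++⁻ˡ (clIII Γ) (Allₚ.++⁻ʳ (clII Γ) (Allₚ.++⁻ʳ (clI Γ) v⊨Cl))

    ⊨IV : All (v ⊨_) (clIV Γ)
    ⊨IV = Allₚ.++⁻ˡ (clIV Γ) (Allₚ.++⁻ʳ (clIII Γ) (Allₚ.++⁻ʳ (clII Γ) (Allₚ.++⁻ʳ (clI Γ) v⊨Cl)))

    ⊨V : All (v ⊨_) (clV Γ)
    ⊨V = Allₚ.++⁻ʳ (clIV Γ) (Allₚ.++⁻ʳ (clIII Γ) (Allₚ.++⁻ʳ (clII Γ) (Allₚ.++⁻ʳ (clI Γ) v⊨Cl)))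

  -- Blocks of Cl Γ built from Defs' local helpers cannot be named; they are located by
  -- their outer shape, e.g. concatMap (λ _ → _) (subs Γ), and unification fills in the rest.
  some-lhs-⊑ᵛ-rhs : ∀ {Cs D} → (Cs ⊑? D) ∈ subs Γ → isVar D ≡ false → Any (_⊑ᵛ D) (toList⁺ Cs)
  some-lhs-⊑ᵛ-rhs {D = atom (con _)} s∈ _
    with All-concatMap⁻ (subs Γ) (Allₚ.++⁻ˡ (concatMap (λ _ → _) (subs Γ)) ⊨I) s∈
  ... | ⊨clause ∷ [] = Anyₚ.map⁻ ⊨clause
  some-lhs-⊑ᵛ-rhs {D = ex _ _} s∈ _
    with All-concatMap⁻ (subs Γ) (Allₚ.++⁻ˡ (concatMap (λ _ → _) (subs Γ)) ⊨I) s∈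
  ... | ⊨clause ∷ [] = Anyₚ.map⁻ ⊨clause

  some-lhs-⊑ᵛ-above-var : ∀ {Cs X E} → (Cs ⊑? X̂ X) ∈ subs Γ → E ∈ Atnv Γ → X̂ X ⊑ᵛ E → Any (_⊑ᵛ E) (toList⁺ Cs)
  some-lhs-⊑ᵛ-above-var s∈ E∈ X⊑E
    with All.lookup (Allₚ.map⁻ (All-concatMap⁻ (subs Γ) (Allₚ.++⁻ˡ (concatMap (λ _ → _) (subs Γ))
           (Allₚ.++⁻ʳ (concatMap (λ _ → _) (subs Γ)) ⊨I)) s∈)) E∈
  ... | here X⋢E     = ⊥-elim (not-¬ X⊑E X⋢E)
  ... | there ⊨clause = Anyₚ.map⁻ ⊨clause

  dissubsumption-⋢ᵛ : ∀ {X Y} → (X ⋢? Y) ∈ diss Γ → X̂ X ⋢ᵛ X̂ Y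
  dissubsumption-⋢ᵛ d∈ with All.lookup (Allₚ.map⁻ (Allₚ.++⁻ʳ (concatMap (λ _ → _) (subs Γ))
                               (Allₚ.++⁻ʳ (concatMap (λ _ → _) (subs Γ)) ⊨I))) d∈
  ... | here X⋢Y = X⋢Y

  con-⊑ᵛ-refl : ∀ {a} → a ∈ Nc Γ → atom (con a) ⊑ᵛ atom (con a)
  con-⊑ᵛ-refl a∈ = Anyₚ.singleton⁻ (All.lookup (Allₚ.map⁻ (Allₚ.++⁻ˡ (map (λ _ → _) (Nc Γ)) ⊨II)) a∈)

  con-⊑ᵛ⇒≡ : ∀ {a b} → a ∈ Nc Γ → b ∈ Nc Γ → atom (con a) ⊑ᵛ atom (con b) → a ≡ b
  con-⊑ᵛ⇒≡ {a} {b} a∈ b∈ a⊑b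
    with All-concatMap⁻ (Nc Γ) (All-concatMap⁻ (Nc Γ) (Allₚ.++⁻ˡ (concatMap (λ _ → _) (Nc Γ))
           (Allₚ.++⁻ʳ (map (λ _ → _) (Nc Γ)) ⊨II)) a∈) b∈
  ... | ⊨distinct with a ℕ.≟ b
  ...   | yes a≡b = a≡b
  ...   | no _    = ⊥-elim (not-¬ a⊑b (Anyₚ.singleton⁻ (All.head ⊨distinct)))

  ∃-⊑ᵛ⇒same-role : ∀ {r A s B} → ex r A ∈ Atnv Γ → ex s B ∈ Atnv Γ → ex r A ⊑ᵛ ex s B → r ≡ s
  ∃-⊑ᵛ⇒same-role {r} {A} {s} {B} rA∈ sB∈ rA⊑sB
    with All-concatMap⁻ _ (All-concatMap⁻ _ (Allₚ.++⁻ˡ (concatMap (λ _ → _) (concatMap (λ _ → _) (Atnv Γ)))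
           (Allₚ.++⁻ʳ (concatMap (λ _ → _) (Nc Γ)) (Allₚ.++⁻ʳ (map (λ _ → _) (Nc Γ)) ⊨II)))
           (∈-concatMap-intro (Atnv Γ) rA∈ (here refl))) (∈-concatMap-intro (Atnv Γ) sB∈ (here refl))
  ... | ⊨roles with r ℕ.≟ s
  ...   | yes r≡s = r≡s
  ...   | no _    = ⊥-elim (not-¬ rA⊑sB (Anyₚ.singleton⁻ (All.head ⊨roles)))

  ∃⊑ᵛ∃⇔⊑ᵛ : ∀ {r A B} → ex r A ∈ Atnv Γ → ex r B ∈ Atnv Γ → ex r A ⊑ᵛ ex r B ⇔ atom A ⊑ᵛ atom B
  ∃⊑ᵛ∃⇔⊑ᵛ {r} {A} {B} rA∈ rB∈
    with All-concatMap⁻ _ (All-concatMap⁻ _ (Allₚ.++⁻ˡ (concatMap (λ _ → _) (concatMap (λ _ → _) (Atnv Γ)))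
           (Allₚ.++⁻ʳ (concatMap (λ _ → _) (Nc Γ)) (Allₚ.++⁻ʳ (map (λ _ → _) (Nc Γ)) ⊨II)))
           (∈-concatMap-intro (Atnv Γ) rA∈ (here refl))) (∈-concatMap-intro (Atnv Γ) rB∈ (here refl))
  ... | ⊨roles with r ℕ.≟ r
  ...   | yes refl = mk⇔ (⊨-⇒⁻ (All.head ⊨roles)) (⊨-⇒⁻ (All.head (All.tail ⊨roles)))
  ...   | no r≢r   = ⊥-elim (r≢r refl)

  con-⋢ᵛ-∃ : ∀ {a r B} → a ∈ Nc Γ → ex r B ∈ Atnv Γ → atom (con a) ⋢ᵛ ex r B × ex r B ⋢ᵛ atom (con a)
  con-⋢ᵛ-∃ a∈ rB∈
    with All-concatMap⁻ _ (All-concatMap⁻ (Nc Γ) (Allₚ.++⁻ʳ (concatMap (λ _ → _) (concatMap (λ _ → _) (Atnv Γ)))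
           (Allₚ.++⁻ʳ (concatMap (λ _ → _) (Nc Γ)) (Allₚ.++⁻ʳ (map (λ _ → _) (Nc Γ)) ⊨II))) a∈)
           (∈-concatMap-intro (Atnv Γ) rB∈ (here refl))
  ... | here a⋢rB ∷ here rB⋢a ∷ [] = a⋢rB , rB⋢a

  ⊑ᵛ-trans : ∀ {C₁ C₂ C₃} → C₁ ∈ At Γ → C₂ ∈ At Γ → C₃ ∈ At Γ → C₁ ⊑ᵛ C₂ → C₂ ⊑ᵛ C₃ → C₁ ⊑ᵛ C₃
  ⊑ᵛ-trans C₁∈ C₂∈ C₃∈ =
    ⊨-⇒₂⁻ (All.lookup (Allₚ.map⁻ (All-concatMap⁻ (At Γ) (All-concatMap⁻ (At Γ) ⊨III C₁∈) C₂∈)) C₃∈)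

  ⊑ᵛ-var-or-witness : ∀ {C X} → C ∈ At Γ → X ∈ Nv Γ →
                      C ⊑ᵛ X̂ X ⊎ ∃[ D ] D ∈ Atnv Γ × X̂ X ⊑ᵛ D × C ⋢ᵛ D
  ⊑ᵛ-var-or-witness C∈ X∈ with All-concatMap⁻ (Nv Γ) (All-concatMap⁻ (At Γ) ⊨IV C∈) X∈
  ... | here C⊑X ∷ _          = inj₁ C⊑X
  ... | there ⊨some-p ∷ ⊨p-clauses with find (Anyₚ.map⁻ ⊨some-p)
  ...   | D , D∈ , pCXD with All-concatMap⁻ (Atnv Γ) ⊨p-clauses D∈
  ...     | ⊨p⇒X⊑D ∷ ⊨¬p∧C⊑D ∷ [] = inj₂ (D , D∈ , ⊨-⇒⁻ ⊨p⇒X⊑D pCXD , ⊨-nand⁻ ⊨¬p∧C⊑D pCXD)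

  >ᵛ-irrefl : ∀ {X} → X ∈ Nv Γ → ¬ (X >ᵛ X)
  >ᵛ-irrefl X∈ X>X =
    not-¬ X>X (Anyₚ.singleton⁻ (All.lookup (Allₚ.map⁻ (Allₚ.++⁻ˡ (map (λ _ → _) (Nv Γ)) ⊨V)) X∈))

  >ᵛ-trans : ∀ {X Y Z} → X ∈ Nv Γ → Y ∈ Nv Γ → Z ∈ Nv Γ → X >ᵛ Y → Y >ᵛ Z → X >ᵛ Z
  >ᵛ-trans X∈ Y∈ Z∈ = ⊨-⇒₂⁻ (All.lookup (Allₚ.map⁻ (All-concatMap⁻ (Nv Γ) (All-concatMap⁻ (Nv Γ)
    (Allₚ.++⁻ˡ (concatMap (λ _ → _) (Nv Γ)) (Allₚ.++⁻ʳ (map (λ _ → _) (Nv Γ)) ⊨V)) X∈) Y∈)) Z∈)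

  ⊑ᵛ∃⇒>ᵛ : ∀ {X r Y} → X ∈ Nv Γ → ex r (var Y) ∈ Atnv Γ → X̂ X ⊑ᵛ ex r (var Y) → X >ᵛ Y
  ⊑ᵛ∃⇒>ᵛ X∈ rY∈ = ⊨-⇒⁻ (All.head (All-concatMap⁻ _ (All-concatMap⁻ (Nv Γ)
    (Allₚ.++⁻ʳ (concatMap (λ _ → _) (Nv Γ)) (Allₚ.++⁻ʳ (map (λ _ → _) (Nv Γ)) ⊨V)) X∈)
    (∈-concatMap-intro (Atnv Γ) rY∈ (here refl))))

  S : ℕ → List FAtom
  S X = filter (λ D → v [ X̂ X ⊑ D ] ≟ᵇ true) (Atnv Γ)

  ∈S⁻ : ∀ {X D} → D ∈ S X → D ∈ Atnv Γ × X̂ X ⊑ᵛ D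
  ∈S⁻ = ∈-filter⁻ _

  ∈S⁺ : ∀ {X D} → D ∈ Atnv Γ → X̂ X ⊑ᵛ D → D ∈ S X
  ∈S⁺ = ∈-filter⁺ _

  S-nonVar : ∀ {X D} → D ∈ S X → isVar D ≡ false
  S-nonVar = proj₂ ∘ ∈-nonVar⁻ (At Γ) ∘ proj₁ ∘ ∈S⁻

  S-occurs⇒>ᵛ : ∀ {X r Y} → X ∈ Nv Γ → ex r (var Y) ∈ S X → Y ∈ Nv Γ × X >ᵛ Y
  S-occurs⇒>ᵛ X∈ rY∈S with ∈S⁻ rY∈S
  ... | rY∈ , X⊑rY = ∃∈Atnv⇒∈Nv rY∈ , ⊑ᵛ∃⇒>ᵛ X∈ rY∈ X⊑rY

  occurs⁺⇒>ᵛ : ∀ {X Y} → X ∈ Nv Γ → TransClosure (Occurs S) X Y → Y ∈ Nv Γ × X >ᵛ Y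
  occurs⁺⇒>ᵛ X∈ [ _ , rY∈S ]⁺ = S-occurs⇒>ᵛ X∈ rY∈S
  occurs⁺⇒>ᵛ X∈ ((_ , rY∈S) ∷⁺ Y⁺Z) with S-occurs⇒>ᵛ X∈ rY∈S
  ... | Y∈ , X>Y with occurs⁺⇒>ᵛ Y∈ Y⁺Z
  ...   | Z∈ , Y>Z = Z∈ , >ᵛ-trans X∈ Y∈ Z∈ X>Y Y>Z

  S-acyclic : IsAcyclicAssignment Γ S
  S-acyclic = (λ _ _ → proj₁ ∘ ∈S⁻) , λ X X∈ X⁺X → >ᵛ-irrefl X∈ (proj₂ (occurs⁺⇒>ᵛ X∈ X⁺X))

  rank : ℕ → ℕ
  rank X = length (filter (λ Y → v [ X > Y ] ≟ᵇ true) (Nv Γ))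

  rank-< : ∀ {X Y} → X ∈ Nv Γ → Y ∈ Nv Γ → X >ᵛ Y → rank Y < rank X
  rank-< X∈ Y∈ X>Y =
    length-filter-strict _ _ (Nv Γ) (λ Z∈ Y>Z → >ᵛ-trans X∈ Y∈ Z∈ X>Y Y>Z) Y∈ X>Y (>ᵛ-irrefl Y∈)

  σ-approx : ℕ → ℕ → Concept
  σ-approx zero    X = ⊤c
  σ-approx (suc k) X = ⨅ (map (λ D → apply (σ-approx k) ⌜ D ⌝) (S X))

  -- Every rank is at most |Nv Γ|, so this many unfoldings already reach the fixed point.
  σ : ℕ → Concept
  σ = σ-approx (suc (length (Nv Γ)))

  σ-approx-stable : ∀ k X → X ∈ Nv Γ → rank X < k → σ-approx k X ≡ σ-approx (suc k) X
  σ-approx-stable (suc k) X X∈ (s≤s rank≤k) = ≡.cong ⨅ (map-cong-local (All.tabulate stable-at))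
    where
    stable-at : ∀ {D} → D ∈ S X → apply (σ-approx k) ⌜ D ⌝ ≡ apply (σ-approx (suc k)) ⌜ D ⌝
    stable-at {atom (var _)} D∈S with () ← S-nonVar D∈S
    stable-at {atom (con _)} _   = refl
    stable-at {ex r (con _)} _   = refl
    stable-at {ex r (var Y)} rY∈S with S-occurs⇒>ᵛ X∈ rY∈S
    ... | Y∈ , X>Y = ≡.cong (∃c r) (σ-approx-stable k Y Y∈ (ℕ.<-≤-trans (rank-< X∈ Y∈ X>Y) rank≤k))

  ⟪_⟫ : FAtom → Concept
  ⟪ D ⟫ = apply σ ⌜ D ⌝

  σ-unfold : ∀ {X} → X ∈ Nv Γ → σ X ≡ ⨅ (map ⟪_⟫ (S X))
  σ-unfold {X} X∈ = σ-approx-stable _ X X∈ (s≤s (length-filter _ (Nv Γ)))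

  σ-approx-ground : ∀ k X → Ground (σ-approx k X)
  σ-approx-ground zero    X = ⊤g
  σ-approx-ground (suc k) X = ⨅-ground (Allₚ.map⁺ (All.universal ground-atom (S X)))
    where
    ground-atom : ∀ D → Ground (apply (σ-approx k) ⌜ D ⌝)
    ground-atom (atom (var Y)) = σ-approx-ground k Y
    ground-atom (atom (con a)) = cong a
    ground-atom (ex r (var Y)) = ∃g (σ-approx-ground k Y)
    ground-atom (ex r (con a)) = ∃g (cong a)

  σ-induced : IsInducedBy Γ S σ
  σ-induced _ = σ-unfold

  open Induced Γ S σ σ-induced

  -- μ drops from X to the atoms of S X and from ∃r.A to A; it bounds the recursions below.
  μₙ : Name → ℕ
  μₙ (var X) = 2 + (rank X + rank X)
  μₙ (con _) = 0

  μ : FAtom → ℕ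
  μ (atom A) = μₙ A
  μ (ex _ A) = suc (μₙ A)

  μ-S : ∀ {X E} → X ∈ Nv Γ → E ∈ S X → μ E < μ (X̂ X)
  μ-S {E = atom (var _)} _  E∈S with () ← S-nonVar E∈S
  μ-S {E = atom (con _)} _  _   = s≤s z≤n
  μ-S {E = ex _ (con _)} _  _   = s≤s (s≤s z≤n)
  μ-S {E = ex _ (var Y)} X∈ E∈S with S-occurs⇒>ᵛ X∈ E∈S
  ... | Y∈ , X>Y = s≤s (s≤s (double-< (rank-< X∈ Y∈ X>Y)))
    where
    double-< : ∀ {m n} → m < n → 2 + (m + m) ≤ n + n
    double-< {m} {n} m<n = ≡.subst (_≤ n + n) (ℕ.+-suc (suc m) m) (ℕ.+-mono-≤ m<n m<n)

  ⊑ᵛ⇒⊑-bounded : ∀ n C D → μ C + μ D < n → C ∈ At Γ → D ∈ At Γ → C ⊑ᵛ D → ⟪ C ⟫ ⊑ ⟪ D ⟫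
  ⊑ᵛ⇒⊑-bounded (suc n) C (atom (var X)) (s≤s μ≤n) C∈ X∈ C⊑X =
    ⊑-induced ⟪ C ⟫ (var∈Nv X∈) (All.tabulate below-S)
    where
    below-S : ∀ {E} → E ∈ S X → ⟪ C ⟫ ⊑ ⟪ E ⟫
    below-S E∈S with ∈S⁻ E∈S
    ... | E∈ , X⊑E =
      ⊑ᵛ⇒⊑-bounded n C _ (ℕ.<-≤-trans (ℕ.+-monoʳ-< (μ C) (μ-S (var∈Nv X∈) E∈S)) μ≤n)
        C∈ (Atnv⊆At E∈) (⊑ᵛ-trans C∈ X∈ (Atnv⊆At E∈) C⊑X X⊑E)
  ⊑ᵛ⇒⊑-bounded (suc n) (atom (var Y)) D@(atom (con _)) _ Y∈ D∈ Y⊑D =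
    induced-⊑ (var∈Nv Y∈) (∈S⁺ (nonVar∈Atnv D∈ refl) Y⊑D)
  ⊑ᵛ⇒⊑-bounded (suc n) (atom (var Y)) D@(ex _ _) _ Y∈ D∈ Y⊑D =
    induced-⊑ (var∈Nv Y∈) (∈S⁺ (nonVar∈Atnv D∈ refl) Y⊑D)
  ⊑ᵛ⇒⊑-bounded (suc n) (atom (con a)) (atom (con b)) _ a∈ b∈ a⊑b
    with con-⊑ᵛ⇒≡ (con∈Nc a∈) (con∈Nc b∈) a⊑b
  ... | refl = ⊑-refl (name (con a))
  ⊑ᵛ⇒⊑-bounded (suc n) (atom (con a)) (ex r B) _ a∈ rB∈ a⊑rB =
    ⊥-elim (not-¬ a⊑rB (proj₁ (con-⋢ᵛ-∃ (con∈Nc a∈) (nonVar∈Atnv rB∈ refl))))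
  ⊑ᵛ⇒⊑-bounded (suc n) (ex r A) (atom (con b)) _ rA∈ b∈ rA⊑b =
    ⊥-elim (not-¬ rA⊑b (proj₂ (con-⋢ᵛ-∃ (con∈Nc b∈) (nonVar∈Atnv rA∈ refl))))
  ⊑ᵛ⇒⊑-bounded (suc n) (ex r A) (ex s B) (s≤s μ≤n) rA∈ sB∈ rA⊑sB
    with ∃-⊑ᵛ⇒same-role (nonVar∈Atnv rA∈ refl) (nonVar∈Atnv sB∈ refl) rA⊑sB
  ... | refl = ∃-mono r (applyN σ A) (applyN σ B)
    (⊑ᵛ⇒⊑-bounded n (atom A) (atom B) (ℕ.<-≤-trans (ℕ.+-mono-< (ℕ.n<1+n _) (ℕ.n<1+n _)) μ≤n)
      (At-∃-closed Γ rA∈) (At-∃-closed Γ sB∈)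
      (Equivalence.to (∃⊑ᵛ∃⇔⊑ᵛ (nonVar∈Atnv rA∈ refl) (nonVar∈Atnv sB∈ refl)) rA⊑sB))

  ⊑ᵛ⇒⊑ : ∀ {C D} → C ∈ At Γ → D ∈ At Γ → C ⊑ᵛ D → ⟪ C ⟫ ⊑ ⟪ D ⟫
  ⊑ᵛ⇒⊑ {C} {D} = ⊑ᵛ⇒⊑-bounded _ C D ℕ.≤-refl

  ⋢ᵛ⇒⋢-bounded : ∀ n C D → μ C + μ D < n → C ∈ At Γ → D ∈ At Γ → C ⋢ᵛ D → ¬ (⟪ C ⟫ ⊑ ⟪ D ⟫)
  var-⋢ᵛ⇒⋢-bounded : ∀ n Y D → isVar D ≡ false → μ (X̂ Y) + μ D < suc n → X̂ Y ∈ At Γ → D ∈ At Γ →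
                     X̂ Y ⋢ᵛ D → ¬ (σ Y ⊑ ⟪ D ⟫)

  ⋢ᵛ⇒⋢-bounded (suc n) C (atom (var X)) (s≤s μ≤n) C∈ X∈ C⋢X C⊑X
    with ⊑ᵛ-var-or-witness C∈ (var∈Nv X∈)
  ... | inj₁ C⊑ᵛX = not-¬ C⊑ᵛX C⋢X
  ... | inj₂ (E , E∈ , X⊑E , C⋢E) =
    ⋢ᵛ⇒⋢-bounded n C E (ℕ.<-≤-trans (ℕ.+-monoʳ-< (μ C) (μ-S (var∈Nv X∈) E∈S)) μ≤n) C∈ (Atnv⊆At E∈) C⋢E
      (⊑-trans ⟪ C ⟫ (σ X) ⟪ E ⟫ C⊑X (induced-⊑ (var∈Nv X∈) E∈S))
    where
    E∈S : E ∈ S X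
    E∈S = ∈S⁺ E∈ X⊑E
  ⋢ᵛ⇒⋢-bounded (suc n) (atom (var Y)) D@(atom (con _)) μ< Y∈ D∈ = var-⋢ᵛ⇒⋢-bounded n Y D refl μ< Y∈ D∈
  ⋢ᵛ⇒⋢-bounded (suc n) (atom (var Y)) D@(ex _ _)       μ< Y∈ D∈ = var-⋢ᵛ⇒⋢-bounded n Y D refl μ< Y∈ D∈
  ⋢ᵛ⇒⋢-bounded (suc n) (atom (con a)) (atom (con b)) _ a∈ _ a⋢b a⊑b with name-⊑-injective (con a) (con b) a⊑b
  ... | refl = not-¬ (con-⊑ᵛ-refl (con∈Nc a∈)) a⋢b
  ⋢ᵛ⇒⋢-bounded (suc n) (atom (con a)) (ex r B) _ _ _ _ = name⋢∃ (con a) r (applyN σ B)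
  ⋢ᵛ⇒⋢-bounded (suc n) (ex r A) (atom (con b)) _ _ _ _ = ∃⋢name r (applyN σ A) (con b)
  ⋢ᵛ⇒⋢-bounded (suc n) (ex r A) (ex s B) (s≤s μ≤n) rA∈ sB∈ rA⋢sB rA⊑sB
    with ∃-⊑-role (applyN σ A) (applyN σ B) rA⊑sB
  ... | refl with v [ atom A ⊑ atom B ] in A⊑?B
  ...   | true  = not-¬ (Equivalence.from (∃⊑ᵛ∃⇔⊑ᵛ (nonVar∈Atnv rA∈ refl) (nonVar∈Atnv sB∈ refl)) A⊑?B) rA⋢sB
  ...   | false =
    ⋢ᵛ⇒⋢-bounded n (atom A) (atom B) (ℕ.<-≤-trans (ℕ.+-mono-< (ℕ.n<1+n _) (ℕ.n<1+n _)) μ≤n)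
      (At-∃-closed Γ rA∈) (At-∃-closed Γ sB∈) A⊑?B (∃-⊑-cancel r (applyN σ A) (applyN σ B) rA⊑sB)

  var-⋢ᵛ⇒⋢-bounded n Y D D-nonVar (s≤s μ≤n) Y∈ D∈ Y⋢D Y⊑D
    with find (Anyₚ.map⁻ (⨅-⊑-atomic (⌜⌝-atomic σ D D-nonVar) (map ⟪_⟫ (S Y))
                 (≡.subst (_⊑ ⟪ D ⟫) (σ-unfold (var∈Nv Y∈)) Y⊑D)))
  ... | E , E∈S , E⊑D with ∈S⁻ E∈S | v [ E ⊑ D ] in E⊑?D
  ...   | E∈ , Y⊑E | true  = not-¬ (⊑ᵛ-trans Y∈ (Atnv⊆At E∈) D∈ Y⊑E E⊑?D) Y⋢D
  ...   | E∈ , _   | false =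
    ⋢ᵛ⇒⋢-bounded n E D (ℕ.<-≤-trans (ℕ.+-monoˡ-< (μ D) (μ-S (var∈Nv Y∈) E∈S)) μ≤n) (Atnv⊆At E∈) D∈ E⊑?D E⊑D

  ⋢ᵛ⇒⋢ : ∀ {C D} → C ∈ At Γ → D ∈ At Γ → C ⋢ᵛ D → ¬ (⟪ C ⟫ ⊑ ⟪ D ⟫)
  ⋢ᵛ⇒⋢ {C} {D} = ⋢ᵛ⇒⋢-bounded _ C D ℕ.≤-refl

  lhs-⊑ : ∀ {Cs D E} → (Cs ⊑? D) ∈ subs Γ → E ∈ At Γ → Any (_⊑ᵛ E) (toList⁺ Cs) →
          ⨅ (map ⟪_⟫ (toList⁺ Cs)) ⊑ ⟪ E ⟫
  lhs-⊑ {Cs} {E = E} s∈ E∈ some⊑E with find some⊑E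
  ... | C , C∈Cs , C⊑E = ⊑-trans (⨅ (map ⟪_⟫ (toList⁺ Cs))) ⟪ C ⟫ ⟪ E ⟫
    (⨅-lower (map ⟪_⟫ (toList⁺ Cs)) (∈-map⁺ ⟪_⟫ C∈Cs)) (⊑ᵛ⇒⊑ (lhs∈At Γ s∈ C∈Cs) E∈ C⊑E)

  σ-solves-subsumption : ∀ {s} → s ∈ subs Γ →
    apply σ (⨅ (map ⌜_⌝ (toList⁺ (Subsumption.lhs s)))) ⊑ apply σ ⌜ Subsumption.rhs s ⌝
  σ-solves-subsumption {Cs ⊑? D} s∈ rewrite apply-⨅-⌜⌝ σ (toList⁺ Cs) with D
  ... | atom (var X) = ⊑-induced (⨅ (map ⟪_⟫ (toList⁺ Cs))) X∈ (All.tabulate below-S)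
    where
    X∈ : X ∈ Nv Γ
    X∈ = var∈Nv (rhs∈At Γ s∈)
    below-S : ∀ {E} → E ∈ S X → ⨅ (map ⟪_⟫ (toList⁺ Cs)) ⊑ ⟪ E ⟫
    below-S E∈S with ∈S⁻ E∈S
    ... | E∈ , X⊑E = lhs-⊑ s∈ (Atnv⊆At E∈) (some-lhs-⊑ᵛ-above-var s∈ E∈ X⊑E)
  ... | atom (con _) = lhs-⊑ s∈ (rhs∈At Γ s∈) (some-lhs-⊑ᵛ-rhs s∈ refl)
  ... | ex _ _       = lhs-⊑ s∈ (rhs∈At Γ s∈) (some-lhs-⊑ᵛ-rhs s∈ refl)

  σ-solves-dissubsumption : ∀ {d} → d ∈ diss Γ → ¬ (σ (Dissubsumption.dl d) ⊑ σ (Dissubsumption.dr d))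
  σ-solves-dissubsumption {X ⋢? Y} d∈ = ⋢ᵛ⇒⋢ (dissˡ∈At Γ d∈) (dissʳ∈At Γ d∈) (dissubsumption-⋢ᵛ d∈)

  localSolution : HasLocalSolution Γ
  localSolution =
    S , σ , S-acyclic , (λ _ → σ-unfold) ,
    ( (λ X _ → σ-approx-ground (suc (length (Nv Γ))) X)
    , All.tabulate σ-solves-subsumption
    , All.tabulate σ-solves-dissubsumption )

-- From a local solution to a satisfying valuation

-- Acyclicity of S only matters for σ_S to exist; here σ is given, so only S X ⊆ At_nv is used.
module LocalSolution⇒Satisfiable (Γ : Problem) (S : ℕ → List FAtom) (σ : ℕ → Concept)
         (S⊆Atnv : ∀ X → X ∈ Nv Γ → S X ⊆ Atnv Γ) (σ-induced : IsInducedBy Γ S σ)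
         (σ-solution : IsSolution Γ σ) where

  open Induced Γ S σ σ-induced

  ⟪_⟫ : FAtom → Concept
  ⟪ D ⟫ = apply σ ⌜ D ⌝

  valuation : PVar → Bool
  valuation [ C ⊑ D ] = does (⊑-dec ⟪ C ⟫ ⟪ D ⟫)
  valuation [ X > Y ] = does (depth (σ Y) <? depth (σ X))
  valuation (p C X D) = does (D ∈? S X ×-dec ¬? (⊑-dec ⟪ C ⟫ ⟪ D ⟫))

  open ClauseShapes valuation

  ⊑⇒⊑ᵛ : ∀ C D → ⟪ C ⟫ ⊑ ⟪ D ⟫ → valuation [ C ⊑ D ] ≡ true
  ⊑⇒⊑ᵛ C D = dec-true (⊑-dec ⟪ C ⟫ ⟪ D ⟫)

  ⋢⇒⋢ᵛ : ∀ C D → ¬ (⟪ C ⟫ ⊑ ⟪ D ⟫) → valuation [ C ⊑ D ] ≡ false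
  ⋢⇒⋢ᵛ C D = dec-false (⊑-dec ⟪ C ⟫ ⟪ D ⟫)

  ⊑ᵛ⇒⊑ : ∀ C D → valuation [ C ⊑ D ] ≡ true → ⟪ C ⟫ ⊑ ⟪ D ⟫
  ⊑ᵛ⇒⊑ C D = does≡true⇒ (⊑-dec ⟪ C ⟫ ⟪ D ⟫)

  >ᵛ⇒depth< : ∀ X Y → valuation [ X > Y ] ≡ true → depth (σ Y) < depth (σ X)
  >ᵛ⇒depth< X Y = does≡true⇒ (depth (σ Y) <? depth (σ X))

  depth<⇒>ᵛ : ∀ X Y → depth (σ Y) < depth (σ X) → valuation [ X > Y ] ≡ true
  depth<⇒>ᵛ X Y = dec-true (depth (σ Y) <? depth (σ X))

  pᵛ⇒ : ∀ C X D → valuation (p C X D) ≡ true → D ∈ S X × ¬ (⟪ C ⟫ ⊑ ⟪ D ⟫)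
  pᵛ⇒ C X D = does≡true⇒ (D ∈? S X ×-dec ¬? (⊑-dec ⟪ C ⟫ ⟪ D ⟫))

  σ-lhs-⊑-rhs : ∀ {Cs D} → (Cs ⊑? D) ∈ subs Γ → ⨅ (map ⟪_⟫ (toList⁺ Cs)) ⊑ ⟪ D ⟫
  σ-lhs-⊑-rhs {Cs} {D} s∈ =
    ≡.subst (_⊑ ⟪ D ⟫) (apply-⨅-⌜⌝ σ (toList⁺ Cs)) (All.lookup (proj₁ (proj₂ σ-solution)) s∈)

  ⊨-some-lhs : ∀ Cs E → isVar E ≡ false → ⨅ (map ⟪_⟫ Cs) ⊑ ⟪ E ⟫ → valuation ⊨ map (λ C → + [ C ⊑ E ]) Cs
  ⊨-some-lhs Cs E E-nonVar ⨅⊑E =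
    Anyₚ.map⁺ (Any.map (λ {C} → ⊑⇒⊑ᵛ C E)
      (Anyₚ.map⁻ (⨅-⊑-atomic (⌜⌝-atomic σ E E-nonVar) (map ⟪_⟫ Cs) ⨅⊑E)))

  clI-holds : ∀ {c} → c ∈ clI Γ → valuation ⊨ c
  clI-holds c∈ with ∈-++⁻ (concatMap (λ _ → _) (subs Γ)) c∈
  ... | inj₁ c∈Ia with ∈-concatMap-elim (subs Γ) c∈Ia
  ...   | Cs ⊑? atom (var _)     , _  , ()
  ...   | Cs ⊑? D@(atom (con _)) , s∈ , here refl = ⊨-some-lhs (toList⁺ Cs) D refl (σ-lhs-⊑-rhs s∈)
  ...   | Cs ⊑? D@(ex _ _)       , s∈ , here refl = ⊨-some-lhs (toList⁺ Cs) D refl (σ-lhs-⊑-rhs s∈)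
  clI-holds c∈ | inj₂ c∈′ with ∈-++⁻ (concatMap (λ _ → _) (subs Γ)) c∈′
  ... | inj₁ c∈Ib with ∈-concatMap-elim (subs Γ) c∈Ib
  ...   | Cs ⊑? atom (con _) , _ , ()
  ...   | Cs ⊑? ex _ _       , _ , ()
  ...   | Cs ⊑? atom (var X) , s∈ , c∈X with ∈-map⁻ _ c∈X
  ...     | E , E∈ , refl with valuation [ X̂ X ⊑ E ] in X⊑?E
  ...       | false = here X⊑?E
  ...       | true  = there (⊨-some-lhs (toList⁺ Cs) E (proj₂ (∈-nonVar⁻ (At Γ) E∈))
                        (⊑-trans (⨅ (map ⟪_⟫ (toList⁺ Cs))) (σ X) ⟪ E ⟫
                          (σ-lhs-⊑-rhs s∈) (⊑ᵛ⇒⊑ (X̂ X) E X⊑?E)))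
  clI-holds c∈ | inj₂ c∈′ | inj₂ c∈Ic with ∈-map⁻ _ c∈Ic
  ... | X ⋢? Y , d∈ , refl = here (⋢⇒⋢ᵛ (X̂ X) (X̂ Y) (All.lookup (proj₂ (proj₂ σ-solution)) d∈))

  clII-holds : ∀ {c} → c ∈ clII Γ → valuation ⊨ c
  clII-holds c∈ with ∈-++⁻ (map (λ _ → _) (Nc Γ)) c∈
  ... | inj₁ c∈IIa with ∈-map⁻ _ c∈IIa
  ...   | a , _ , refl = here (⊑⇒⊑ᵛ (atom (con a)) (atom (con a)) (⊑-refl (name (con a))))
  clII-holds c∈ | inj₂ c∈′ with ∈-++⁻ (concatMap (λ _ → _) (Nc Γ)) c∈′
  ... | inj₁ c∈IIb with ∈-concatMap-elim (Nc Γ) c∈IIb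
  ...   | a , _ , c∈a with ∈-concatMap-elim (Nc Γ) c∈a
  ...     | b , _ , c∈ab with a ℕ.≟ b
  ...       | yes _ with () ← c∈ab
  ...       | no a≢b with c∈ab
  ...         | here refl = here (⋢⇒⋢ᵛ (atom (con a)) (atom (con b))
                              (λ a⊑b → a≢b (con-injective (name-⊑-injective (con a) (con b) a⊑b))))
    where
    con-injective : ∀ {a b} → con a ≡ con b → a ≡ b
    con-injective refl = refl
  clII-holds c∈ | inj₂ c∈′ | inj₂ c∈″ with ∈-++⁻ (concatMap (λ _ → _) (concatMap (λ _ → _) (Atnv Γ))) c∈″
  ... | inj₁ c∈IIce with ∈-concatMap-elim (concatMap (λ _ → _) (Atnv Γ)) c∈IIce
  ...   | (r , A) , _ , c∈rA with ∈-concatMap-elim (concatMap (λ _ → _) (Atnv Γ)) c∈rA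
  ...     | (s , B) , _ , c∈rAsB with r ℕ.≟ s
  ...       | no r≢s with c∈rAsB
  ...         | here refl = here (⋢⇒⋢ᵛ (ex r A) (ex s B) (r≢s ∘ ∃-⊑-role (applyN σ A) (applyN σ B)))
  clII-holds c∈ | inj₂ c∈′ | inj₂ c∈″ | inj₁ c∈IIce | (r , A) , _ , c∈rA | (r , B) , _ , c∈rAsB | yes refl
    with c∈rAsB
  ... | here refl =
    ⊨-⇒⁺ (⊑⇒⊑ᵛ (atom A) (atom B) ∘ ∃-⊑-cancel r (applyN σ A) (applyN σ B) ∘ ⊑ᵛ⇒⊑ (ex r A) (ex r B))
  ... | there (here refl) =
    ⊨-⇒⁺ (⊑⇒⊑ᵛ (ex r A) (ex r B) ∘ ∃-mono r (applyN σ A) (applyN σ B) ∘ ⊑ᵛ⇒⊑ (atom A) (atom B))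
  clII-holds c∈ | inj₂ c∈′ | inj₂ c∈″ | inj₂ c∈IId with ∈-concatMap-elim (Nc Γ) c∈IId
  ... | a , _ , c∈a with ∈-concatMap-elim (concatMap (λ _ → _) (Atnv Γ)) c∈a
  ...   | (r , B) , _ , here refl         = here (⋢⇒⋢ᵛ (atom (con a)) (ex r B) (name⋢∃ (con a) r (applyN σ B)))
  ...   | (r , B) , _ , there (here refl) = here (⋢⇒⋢ᵛ (ex r B) (atom (con a)) (∃⋢name r (applyN σ B) (con a)))

  clIII-holds : ∀ {c} → c ∈ clIII Γ → valuation ⊨ c
  clIII-holds c∈ with ∈-concatMap-elim (At Γ) c∈
  ... | C₁ , _ , c∈₁ with ∈-concatMap-elim (At Γ) c∈₁
  ...   | C₂ , _ , c∈₂ with ∈-map⁻ _ c∈₂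
  ...     | C₃ , _ , refl = ⊨-⇒₂⁺ λ C₁⊑C₂ C₂⊑C₃ →
    ⊑⇒⊑ᵛ C₁ C₃ (⊑-trans ⟪ C₁ ⟫ ⟪ C₂ ⟫ ⟪ C₃ ⟫ (⊑ᵛ⇒⊑ C₁ C₂ C₁⊑C₂) (⊑ᵛ⇒⊑ C₂ C₃ C₂⊑C₃))

  ⊑var-or-witness : ∀ C {X} → X ∈ Nv Γ → valuation ⊨ (+ [ C ⊑ X̂ X ]) ∷ map (λ D → + p C X D) (Atnv Γ)
  ⊑var-or-witness C {X} X∈ with ⊑-dec ⟪ C ⟫ (σ X)
  ... | yes C⊑X = here (⊑⇒⊑ᵛ C (X̂ X) C⊑X)
  ... | no C⋢X with find (Allₚ.¬All⇒Any¬ (λ D → ⊑-dec ⟪ C ⟫ ⟪ D ⟫) (S X) (C⋢X ∘ ⊑-induced ⟪ C ⟫ X∈))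
  ...   | D , D∈S , C⋢D =
    there (Anyₚ.map⁺ (lose (S⊆Atnv X X∈ D∈S)
      (dec-true (D ∈? S X ×-dec ¬? (⊑-dec ⟪ C ⟫ ⟪ D ⟫)) (D∈S , C⋢D))))

  clIV-holds : ∀ {c} → c ∈ clIV Γ → valuation ⊨ c
  clIV-holds c∈ with ∈-concatMap-elim (At Γ) c∈
  ... | C , _ , c∈C with ∈-concatMap-elim (Nv Γ) c∈C
  ...   | X , X∈ , here refl = ⊑var-or-witness C X∈
  ...   | X , X∈ , there c∈p with ∈-concatMap-elim (Atnv Γ) c∈p
  ...     | D , _ , here refl         = ⊨-⇒⁺ (⊑⇒⊑ᵛ (X̂ X) D ∘ induced-⊑ X∈ ∘ proj₁ ∘ pᵛ⇒ C X D)
  ...     | D , _ , there (here refl) = ⊨-nand⁺ (⋢⇒⋢ᵛ C D ∘ proj₂ ∘ pᵛ⇒ C X D)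

  clV-holds : ∀ {c} → c ∈ clV Γ → valuation ⊨ c
  clV-holds c∈ with ∈-++⁻ (map (λ _ → _) (Nv Γ)) c∈
  ... | inj₁ c∈Va with ∈-map⁻ _ c∈Va
  ...   | X , _ , refl = here (dec-false (depth (σ X) <? depth (σ X)) (ℕ.<-irrefl refl))
  clV-holds c∈ | inj₂ c∈′ with ∈-++⁻ (concatMap (λ _ → _) (Nv Γ)) c∈′
  ... | inj₁ c∈Vb with ∈-concatMap-elim (Nv Γ) c∈Vb
  ...   | X , _ , c∈X with ∈-concatMap-elim (Nv Γ) c∈X
  ...     | Y , _ , c∈XY with ∈-map⁻ _ c∈XY
  ...       | Z , _ , refl = ⊨-⇒₂⁺ λ X>Y Y>Z →
    depth<⇒>ᵛ X Z (ℕ.<-trans (>ᵛ⇒depth< Y Z Y>Z) (>ᵛ⇒depth< X Y X>Y))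
  clV-holds c∈ | inj₂ c∈′ | inj₂ c∈Vc with ∈-concatMap-elim (Nv Γ) c∈Vc
  ... | X , _ , c∈X with ∈-concatMap-elim (concatMap (λ _ → _) (Atnv Γ)) c∈X
  ...   | (r , var Y) , _ , here refl = ⊨-⇒⁺ λ X⊑rY →
    depth<⇒>ᵛ X Y (⊑∃⇒depth< (σ X) r (σ Y) (⊑ᵛ⇒⊑ (X̂ X) (ex r (var Y)) X⊑rY))
  ...   | (r , con _) , _ , ()

  Cl-holds : ∀ {c} → c ∈ Cl Γ → valuation ⊨ c
  Cl-holds c∈ with ∈-++⁻ (clI Γ) c∈
  ... | inj₁ c∈I = clI-holds c∈I
  ... | inj₂ c∈₁ with ∈-++⁻ (clII Γ) c∈₁
  ...   | inj₁ c∈II = clII-holds c∈II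
  ...   | inj₂ c∈₂ with ∈-++⁻ (clIII Γ) c∈₂
  ...     | inj₁ c∈III = clIII-holds c∈III
  ...     | inj₂ c∈₃ with ∈-++⁻ (clIV Γ) c∈₃
  ...       | inj₁ c∈IV = clIV-holds c∈IV
  ...       | inj₂ c∈V  = clV-holds c∈V

  satisfiable : Satisfiable (Cl Γ)
  satisfiable = valuation , All.tabulate Cl-holds

theorem6p7 : (Γ : Problem) → HasLocalSolution Γ ⇔ Satisfiable (Cl Γ)
theorem6p7 Γ = mk⇔
  (λ { (S , σ , acyclic , induced , solution) →
         LocalSolution⇒Satisfiable.satisfiable Γ S σ (proj₁ acyclic) induced solution })
  (λ { (v , v⊨Cl) → Satisfiable⇒LocalSolution.localSolution Γ v v⊨Cl })
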